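{- Let $m\ge 3$, $n\ge 5$, and let $S$ be a self-identifying code of $K_m\times P_n$. Let $i\in[0,m-1]$ and $j\in[2,n-3]$, and suppose $(v_i,j)\notin S$. Then: (1) for every $i'\in[0,m-1]$ with $i'\neq i$, $S$ contains at least one vertex of $\{(v_{i'},j-1),(v_{i'},j+1)\}$; consequently $|N[(v_i,j)]\cap S|\ge m-1$; (2) $S\cap C_{j-1}\neq\emptyset$ and $S\cap C_{j+1}\neq\emptyset$.
   Context: $[a,b]=\{a,a+1,\dots,b\}$. For a vertex $v$, $N[v]$ is its closed neighborhood. A nonempty set $S\subseteq V(G)$ is a self-identifying code of $G$ if for every vertex $v\in V(G)$: (1) $N[v]\cap S\neq\emptyset$, and (2) $\bigcap_{c\in N[v]\cap S}N[c]=\{v\}$. With $V(K_m)=\{v_0,\dots,v_{m-1}\}$ and $V(P_n)=\{0,\dots,n-1\}$ (consecutively numbered path), $K_m\times P_n$ has vertices $(v_i,j)$, with $(v_i,j)$ adjacent to $(v_{i'},j')$ iff $i\neq i'$ and $|j-j'|=1$. The $j$-th column is $C_j=\{(v_i,j):0\le i\le m-1\}$. -}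

module Defs where

open import Data.Nat using (ℕ; zero; suc; _+_; _∸_; _≤_)
open import Data.Fin using (Fin; toℕ)
open import Data.Bool using (Bool; true; false; T)
open import Data.Product using (_×_; _,_; proj₁; proj₂; Σ; ∃)
open import Data.Sum using (_⊎_)
open import Relation.Binary.PropositionalEquality using (_≡_)
open import Relation.Nullary using (¬_; Dec; yes; no)
open import Relation.Nullary.Decidable using (⌊_⌋)
open import Data.Bool using (_∧_; _∨_; not)
open import Data.Fin using (_≟_)
import Data.Nat as ℕ
open import Data.List using (List; length; filter; allFin; cartesianProduct)
open import Function.Bundles using (_⇔_)

-- Vertices of K_m × P_n : (v_i , j) ↦ (i , j) with i : Fin m, j : Fin n.
Vtx : ℕ → ℕ → Set
Vtx m n = Fin m × Fin n

dist1 : ℕ → ℕ → Bool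
dist1 a b = ⌊ suc a ℕ.≟ b ⌋ ∨ ⌊ suc b ℕ.≟ a ⌋

adj : ∀ {m n} → Vtx m n → Vtx m n → Bool
adj (i , j) (i' , j') = not ⌊ i ≟ i' ⌋ ∧ dist1 (toℕ j) (toℕ j')

inNbhd : ∀ {m n} → Vtx m n → Vtx m n → Bool
inNbhd (i , j) (i' , j') =
  (⌊ i ≟ i' ⌋ ∧ ⌊ j ≟ j' ⌋) ∨ adj (i , j) (i' , j')

_∈N[_] : ∀ {m n} → Vtx m n → Vtx m n → Set
u ∈N[ v ] = T (inNbhd v u)

VSet : ℕ → ℕ → Set
VSet m n = Vtx m n → Bool

_∈S_ : ∀ {m n} → Vtx m n → VSet m n → Set
u ∈S S = T (S u)

inBigCap : ∀ {m n} → VSet m n → Vtx m n → Vtx m n → Set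
inBigCap S v w = ∀ c → c ∈S S → c ∈N[ v ] → w ∈N[ c ]

SelfIdentifyingCode : ∀ {m n} → VSet m n → Set
SelfIdentifyingCode {m} {n} S =
  (∃ λ u → u ∈S S) ×
  (∀ (v : Vtx m n) →
     (∃ λ c → c ∈S S × c ∈N[ v ]) ×
     (∀ w → inBigCap S v w ⇔ (w ≡ v)))

allVtx : ∀ m n → List (Vtx m n)
allVtx m n = cartesianProduct (allFin m) (allFin n)

nbhdCount : ∀ {m n} → VSet m n → Vtx m n → ℕ
nbhdCount {m} {n} S v =
  length (filter (λ u → T? (S u ∧ inNbhd v u)) (allVtx m n))
  where
    T? : (b : Bool) → Dec (T b)
    T? true = yes _
    T? false = no (λ ())

module Submission where

-- A codeword in N[v] for v = (v_i, j) ∉ S is some (v_k, j ± 1) with k ≠ i. Any vertex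
-- w ≠ v adjacent to all of them would lie in ⋂ N[c] = {v}. If a row i' ≠ i had no
-- codeword in columns j ± 1, w = (v_i', j) would be such a vertex; if column j − 1
-- (resp. j + 1) had no codeword, w = (v_i, j + 2) (resp. (v_i, j − 2)) would be.
-- The codewords found in distinct rows are distinct, which gives the bound m − 1.

open import Defs
open import Data.Nat using (ℕ; _≤_; _∸_; suc; _+_)
open import Data.Fin using (Fin; toℕ)
open import Data.Product using (_×_; _,_; ∃)
open import Data.Sum using (_⊎_)
open import Relation.Binary.PropositionalEquality using (_≡_)
open import Relation.Nullary using (¬_)

open import Level using (0ℓ)
open import Function using (_∘_; id)
open import Function.Bundles using (Equivalence)
open import Data.Nat using (_<_; z≤n; s≤s)
import Data.Nat as ℕ
open import Data.Nat.Properties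
  using (module ≤-Reasoning; ≤-trans; <-trans; ≤-reflexive; +-comm; +-mono-≤; m≤n+m;
         ∸-monoˡ-≤; m≤n⇒∃[o]m+o≡n; m≢1+n+m; suc-injective)
open import Data.Fin using (fromℕ<; _≟_)
open import Data.Fin.Properties using (toℕ-fromℕ<; toℕ<n; any?)
open import Data.Bool using (T; _∧_)
open import Data.Bool.Properties using (T-∧; T-∨)
open import Data.Product using (proj₁; proj₂)
import Data.Product as Product
open import Data.Sum using (inj₁; inj₂)
import Data.Sum as Sum
open import Data.Empty using (⊥-elim)
open import Data.List using (List; []; _∷_; _++_; length; filter; map; allFin; cartesianProduct)
open import Data.List.Properties using (filter-++; length-++; filter-all; length-tabulate)
open import Data.List.Membership.Propositional using (_∈_)
open import Data.List.Membership.Propositional.Properties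
  using (∈-allFin; ∈-map⁺; ∈-filter⁺; ∈-length)
import Data.List.Relation.Unary.All as All
open import Data.List.Relation.Unary.AllPairs using (_∷_)
open import Data.List.Relation.Unary.Unique.Propositional using (Unique)
open import Data.List.Relation.Unary.Unique.Propositional.Properties using (allFin⁺)
open import Relation.Binary.Definitions using (DecidableEquality)
open import Relation.Binary.PropositionalEquality using (_≢_; refl; sym; trans; cong; ≢-sym)
open import Relation.Nullary using (Dec; yes; no; ¬?)
open import Relation.Nullary.Decidable
  using (_⊎-dec_; _×-dec_; T?; toWitness; fromWitness; toWitnessFalse; fromWitnessFalse)
open import Relation.Unary using (Pred; Decidable)

open ≤-Reasoning

module _ {A B : Set} {P : Pred (A × B) 0ℓ} (P? : Decidable P) where

  length-filter≤length-filter-cartesianProduct :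
    {C : Pred A 0ℓ} (C? : Decidable C) (xs : List A) (ys : List B) →
    (∀ x → C x → ∃ λ y → y ∈ ys × P (x , y)) →
    length (filter C? xs) ≤ length (filter P? (cartesianProduct xs ys))
  length-filter≤length-filter-cartesianProduct C? [] ys f = z≤n
  length-filter≤length-filter-cartesianProduct C? (x ∷ xs) ys f = begin
    length (filter C? (x ∷ xs))
      ≤⟨ head-and-tail ⟩
    length (filter P? (map (x ,_) ys)) + length (filter P? (cartesianProduct xs ys))
      ≡⟨ length-++ (filter P? (map (x ,_) ys)) ⟨
    length (filter P? (map (x ,_) ys) ++ filter P? (cartesianProduct xs ys))
      ≡⟨ cong length (filter-++ P? (map (x ,_) ys) (cartesianProduct xs ys)) ⟨
    length (filter P? (cartesianProduct (x ∷ xs) ys)) ∎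
    where
    ih : length (filter C? xs) ≤ length (filter P? (cartesianProduct xs ys))
    ih = length-filter≤length-filter-cartesianProduct C? xs ys f
    head-and-tail : length (filter C? (x ∷ xs)) ≤
      length (filter P? (map (x ,_) ys)) + length (filter P? (cartesianProduct xs ys))
    head-and-tail with C? x
    ... | yes Cx = let (y , y∈ys , Pxy) = f x Cx in
                   +-mono-≤ (∈-length (∈-filter⁺ P? (∈-map⁺ (x ,_) y∈ys) Pxy)) ih
    ... | no _ = ≤-trans ih (m≤n+m _ _)

length≤suc-length-filter-≢ : {A : Set} (_≟ᴬ_ : DecidableEquality A) (a : A) (xs : List A) →
  Unique xs → length xs ≤ suc (length (filter (λ x → ¬? (x ≟ᴬ a)) xs))
length≤suc-length-filter-≢ _≟ᴬ_ a [] _ = z≤n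
length≤suc-length-filter-≢ _≟ᴬ_ a (x ∷ xs) (x≢xs ∷ unique) with x ≟ᴬ a
... | yes refl =
  ≤-reflexive (cong (suc ∘ length) (sym (filter-all (λ y → ¬? (y ≟ᴬ a)) (All.map ≢-sym x≢xs))))
... | no _ = s≤s (length≤suc-length-filter-≢ _≟ᴬ_ a xs unique)

Consecutive : ℕ → ℕ → Set
Consecutive x y = suc x ≡ y ⊎ x ≡ suc y

consecutive? : ∀ x y → Dec (Consecutive x y)
consecutive? x y = (suc x ℕ.≟ y) ⊎-dec (x ℕ.≟ suc y)

Consecutive-sym : ∀ {x y} → Consecutive x y → Consecutive y x
Consecutive-sym = Sum.swap ∘ Sum.map sym sym

dist1⇒Consecutive : ∀ x y → T (dist1 x y) → Consecutive x y
dist1⇒Consecutive x y =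
  Sum.map (toWitness {a? = suc x ℕ.≟ y}) (sym ∘ toWitness {a? = suc y ℕ.≟ x}) ∘ Equivalence.to T-∨

Consecutive⇒dist1 : ∀ x y → Consecutive x y → T (dist1 x y)
Consecutive⇒dist1 x y =
  Equivalence.from T-∨ ∘ Sum.map (fromWitness {a? = suc x ℕ.≟ y}) (fromWitness {a? = suc y ℕ.≟ x} ∘ sym)

∈N[]⇒ : ∀ {m n} {i k : Fin m} {j l : Fin n} → (k , l) ∈N[ (i , j) ] →
  (i ≡ k × j ≡ l) ⊎ (i ≢ k × Consecutive (toℕ j) (toℕ l))
∈N[]⇒ {i = i} {k} {j} {l} =
  Sum.map (Product.map (toWitness {a? = i ≟ k}) (toWitness {a? = j ≟ l}) ∘ Equivalence.to T-∧)
          (Product.map (toWitnessFalse {a? = i ≟ k}) (dist1⇒Consecutive _ _) ∘ Equivalence.to T-∧)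
  ∘ Equivalence.to T-∨

neighbour⇒∈N[] : ∀ {m n} {i k : Fin m} {j l : Fin n} →
  i ≢ k → Consecutive (toℕ j) (toℕ l) → (k , l) ∈N[ (i , j) ]
neighbour⇒∈N[] {i = i} {k} i≢k c =
  Equivalence.from T-∨ (inj₂ (Equivalence.from T-∧
    (fromWitnessFalse {a? = i ≟ k} i≢k , Consecutive⇒dist1 _ _ c)))

codeword-∈N[]⇒neighbour : ∀ {m n} {S : VSet m n} {i k : Fin m} {j l : Fin n} →
  ¬ (i , j) ∈S S → (k , l) ∈S S → (k , l) ∈N[ (i , j) ] →
  i ≢ k × Consecutive (toℕ j) (toℕ l)
codeword-∈N[]⇒neighbour {i = i} {k} {j} {l} v∉S c∈S c∈N[v] with ∈N[]⇒ {i = i} {k} {j} {l} c∈N[v]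
... | inj₁ (refl , refl) = ⊥-elim (v∉S c∈S)
... | inj₂ neighbour = neighbour

codewordNeighbours-separate : ∀ {m n} {S : VSet m n} {i : Fin m} {j : Fin n} →
  SelfIdentifyingCode S → ¬ (i , j) ∈S S →
  (w : Vtx m n) → w ≢ (i , j) →
  ¬ (∀ k l → (k , l) ∈S S → i ≢ k → Consecutive (toℕ j) (toℕ l) → w ∈N[ (k , l) ])
codewordNeighbours-separate (_ , code) v∉S w w≢v adjacent =
  w≢v (Equivalence.to (proj₂ (code _) w) λ (k , l) c∈S c∈N[v] →
    let (i≢k , c) = codeword-∈N[]⇒neighbour v∉S c∈S c∈N[v] in adjacent k l c∈S i≢k c)

codeword-in-row : ∀ {m n} {S : VSet m n} {i : Fin m} {j : Fin n} →
  SelfIdentifyingCode S → ¬ (i , j) ∈S S → (i' : Fin m) → i' ≢ i →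
  ∃ λ l → Consecutive (toℕ l) (toℕ j) × (i' , l) ∈S S
codeword-in-row {S = S} {i = i} {j = j} code v∉S i' i'≢i
  with any? (λ l → consecutive? (toℕ l) (toℕ j) ×-dec T? (S (i' , l)))
... | yes found = found
... | no none =
  ⊥-elim (codewordNeighbours-separate code v∉S (i' , j) (i'≢i ∘ cong proj₁) adjacent)
  where
  adjacent : ∀ k l → (k , l) ∈S S → i ≢ k → Consecutive (toℕ j) (toℕ l) → (i' , j) ∈N[ (k , l) ]
  adjacent k l c∈S _ c = neighbour⇒∈N[] k≢i' (Consecutive-sym c)
    where
    k≢i' : k ≢ i'
    k≢i' refl = none (l , Consecutive-sym c , c∈S)

codeword-in-column : ∀ {m n} {S : VSet m n} {i : Fin m} {j : Fin n} →
  SelfIdentifyingCode S → ¬ (i , j) ∈S S →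
  {C : Pred (Fin n) 0ℓ} → Decidable C → (w : Fin n) → toℕ w ≢ toℕ j →
  (∀ l → Consecutive (toℕ j) (toℕ l) → ¬ C l → Consecutive (toℕ l) (toℕ w)) →
  ∃ λ k → ∃ λ l → C l × (k , l) ∈S S
codeword-in-column {S = S} {i = i} {j = j} code v∉S C? w w≢j beside
  with any? (λ k → any? (λ l → C? l ×-dec T? (S (k , l))))
... | yes found = found
... | no none =
  ⊥-elim (codewordNeighbours-separate code v∉S (i , w) (w≢j ∘ cong (toℕ ∘ proj₂)) adjacent)
  where
  adjacent : ∀ k l → (k , l) ∈S S → i ≢ k → Consecutive (toℕ j) (toℕ l) → (i , w) ∈N[ (k , l) ]
  adjacent k l c∈S i≢k c = neighbour⇒∈N[] (≢-sym i≢k) (beside l c λ Cl → none (k , l , Cl , c∈S))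

codeword-in-previous-column : ∀ {m n} {S : VSet m n} {i : Fin m} {j : Fin n} →
  SelfIdentifyingCode S → ¬ (i , j) ∈S S → toℕ j + 3 ≤ n →
  ∃ λ k → ∃ λ l → suc (toℕ l) ≡ toℕ j × (k , l) ∈S S
codeword-in-previous-column {n = n} {j = j} code v∉S j+3≤n =
  codeword-in-column code v∉S (λ l → suc (toℕ l) ℕ.≟ toℕ j) w w≢j beside
  where
  j+2<n : 2 + toℕ j < n
  j+2<n = ≤-trans (≤-reflexive (+-comm 3 (toℕ j))) j+3≤n
  w : Fin n
  w = fromℕ< j+2<n
  w≢j : toℕ w ≢ toℕ j
  w≢j w≡j = m≢1+n+m (toℕ j) (trans (sym w≡j) (toℕ-fromℕ< j+2<n))
  beside : ∀ l → Consecutive (toℕ j) (toℕ l) → suc (toℕ l) ≢ toℕ j → Consecutive (toℕ l) (toℕ w)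
  beside l (inj₁ j+1≡l) _ = inj₁ (trans (cong suc (sym j+1≡l)) (sym (toℕ-fromℕ< j+2<n)))
  beside l (inj₂ j≡l+1) l+1≢j = ⊥-elim (l+1≢j (sym j≡l+1))

codeword-in-next-column : ∀ {m n} {S : VSet m n} {i : Fin m} {j : Fin n} →
  SelfIdentifyingCode S → ¬ (i , j) ∈S S → 2 ≤ toℕ j →
  ∃ λ k → ∃ λ l → toℕ l ≡ suc (toℕ j) × (k , l) ∈S S
codeword-in-next-column {n = n} {j = j} code v∉S 2≤j with m≤n⇒∃[o]m+o≡n 2≤j
... | d , 2+d≡j = codeword-in-column code v∉S (λ l → toℕ l ℕ.≟ suc (toℕ j)) w w≢j beside
  where
  d<n : d < n
  d<n = <-trans (≤-trans (m≤n+m (suc d) 1) (≤-reflexive 2+d≡j)) (toℕ<n j)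
  w : Fin n
  w = fromℕ< d<n
  w≢j : toℕ w ≢ toℕ j
  w≢j w≡j = m≢1+n+m d (trans (sym (toℕ-fromℕ< d<n)) (trans w≡j (sym 2+d≡j)))
  beside : ∀ l → Consecutive (toℕ j) (toℕ l) → toℕ l ≢ suc (toℕ j) → Consecutive (toℕ l) (toℕ w)
  beside l (inj₁ j+1≡l) l≢j+1 = ⊥-elim (l≢j+1 (sym j+1≡l))
  beside l (inj₂ j≡l+1) _ =
    inj₂ (trans (sym (suc-injective (trans 2+d≡j j≡l+1))) (cong suc (sym (toℕ-fromℕ< d<n))))

m∸1≤nbhdCount : ∀ {m n} (S : VSet m n) (i : Fin m) (j : Fin n) →
  (∀ i' → i' ≢ i → ∃ λ l → (i' , l) ∈S S × (i' , l) ∈N[ (i , j) ]) →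
  m ∸ 1 ≤ nbhdCount S (i , j)
m∸1≤nbhdCount {m} {n} S i j row = begin
  m ∸ 1
    ≡⟨ cong (_∸ 1) (length-tabulate {A = Fin m} id) ⟨
  length (allFin m) ∸ 1
    ≤⟨ ∸-monoˡ-≤ 1 (length≤suc-length-filter-≢ _≟_ i (allFin m) (allFin⁺ m)) ⟩
  length (filter (λ i' → ¬? (i' ≟ i)) (allFin m))
    ≤⟨ length-filter≤length-filter-cartesianProduct _ _ (allFin m) (allFin n) codeword ⟩
  nbhdCount S (i , j) ∎
  where
  codeword : ∀ i' → i' ≢ i →
    ∃ λ l → l ∈ allFin n × T (S (i' , l) ∧ inNbhd (i , j) (i' , l))
  codeword i' i'≢i = let (l , c∈S , c∈N[v]) = row i' i'≢i in
    l , ∈-allFin l , Equivalence.from T-∧ (c∈S , c∈N[v])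

lemma10 : (m n : ℕ) → 3 ≤ m → 5 ≤ n →
    (S : VSet m n) → SelfIdentifyingCode S →
    (i : Fin m) (j : Fin n) → 2 ≤ toℕ j → toℕ j + 3 ≤ n →
    ¬ ((i , j) ∈S S) →
    ((∀ (i' : Fin m) → ¬ (i' ≡ i) →
        ∃ λ (j' : Fin n) → (suc (toℕ j') ≡ toℕ j ⊎ toℕ j' ≡ suc (toℕ j))
                          × ((i' , j') ∈S S))
     × m ∸ 1 ≤ nbhdCount S (i , j))
    × (∃ λ (i₁ : Fin m) → ∃ λ (j₁ : Fin n) → suc (toℕ j₁) ≡ toℕ j × ((i₁ , j₁) ∈S S))
    × (∃ λ (i₂ : Fin m) → ∃ λ (j₂ : Fin n) → toℕ j₂ ≡ suc (toℕ j) × ((i₂ , j₂) ∈S S))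
lemma10 m n _ _ S code i j 2≤j j+3≤n v∉S =
  (row , m∸1≤nbhdCount S i j row-neighbour)
  , codeword-in-previous-column code v∉S j+3≤n
  , codeword-in-next-column code v∉S 2≤j
  where
  row : ∀ i' → i' ≢ i → ∃ λ l → Consecutive (toℕ l) (toℕ j) × (i' , l) ∈S S
  row = codeword-in-row code v∉S
  row-neighbour : ∀ i' → i' ≢ i → ∃ λ l → (i' , l) ∈S S × (i' , l) ∈N[ (i , j) ]
  row-neighbour i' i'≢i = let (l , c , c∈S) = row i' i'≢i in
    l , c∈S , neighbour⇒∈N[] (≢-sym i'≢i) (Consecutive-sym c)
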